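{- Let $q=p^k$, let $0\leq i,i'\leq q-2$ be distinct, $0\leq j\leq k-1$, and $y,y'\in\mathbb{F}_q^*$. In the derangement graph of $\Gamma\mathrm{L}(2,q)$, the subgraph induced by $\omega^i\varphi^j\mathcal{E}(y)\cup\omega^{i'}\varphi^j\mathcal{E}(y')$ is a coclique if and only if $y'=y\,\omega^{(i-i')p^{k-j}}$; if $y'\neq y\,\omega^{(i-i')p^{k-j}}$, this subgraph is the complete bipartite graph $K_{q,q}$ with parts $\omega^i\varphi^j\mathcal{E}(y)$ and $\omega^{i'}\varphi^j\mathcal{E}(y')$. In particular, the subgraph induced by $V_{i,j}\cup V_{i',j}$ is isomorphic to $\widetilde{K}_{q-1}^2\left[\overline{K_q}\right]$.
   Context: $\omega$ is a fixed primitive element of $\mathbb{F}_q$, $\varphi:x\mapsto x^p$. $\Gamma\mathrm{L}(2,q)$ is the group of maps $v\mapsto Av^{\varphi^i}$ ($A\in\mathrm{GL}(2,q)$, $\varphi^i$ applied entrywise) acting on non-zero vectors of $\mathbb{F}_q^2$; in products, a matrix $M$ denotes $v\mapsto Mv$, $\varphi^j$ denotes $v\mapsto v^{\varphi^j}$, $\omega^i$ the scalar map $v\mapsto\omega^i v$, and juxtaposition is composition; for a set $S$, $gS=\{gs:s\in S\}$. The derangement graph has vertex set $\Gamma\mathrm{L}(2,q)$, with $g\sim h$ iff $h^{ -1}g$ fixes no non-zero vector. $\mathcal{E}(y)=\{\begin{bmatrix}1&z\\0&y\end{bmatrix}:z\in\mathbb{F}_q\}$ and $V_{i,j}=\{\omega^i\varphi^j\begin{bmatrix}1&z\\0&y\end{bmatrix}: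 z\in\mathbb{F}_q, y\in\mathbb{F}_q^*\}$. $K_n$ is the complete graph, $\overline{K_n}$ its complement; $K_n^t$ is the complete multipartite graph with $t$ parts of size $n$, and $\widetilde{K}_n^t$ is obtained from $K_n^t$ by deleting the edges of $n$ vertex-disjoint copies of $K_t$ (the result is independent of the choice up to isomorphism). The lexicographic product $X[Y]$ has vertex set $V(X)\times V(Y)$, with $(x,y)\sim(x',y')$ iff $x\sim_X x'$, or $x=x'$ and $y\sim_Y y'$. -}

module Defs where

open import Data.Nat using (ℕ; zero; suc; _^_; _∸_; _<_)
open import Data.Integer as ℤ using (ℤ; +_; -[1+_])
open import Data.Fin using (Fin; toℕ)
open import Data.Product using (Σ; ∃; ∃-syntax; _×_; _,_)
open import Data.Sum using (_⊎_)
open import Data.Empty using (⊥)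
open import Relation.Nullary using (¬_)
open import Relation.Binary.PropositionalEquality using (_≡_; _≢_)
open import Function.Bundles using (_↔_)
open import Algebra.Structures using (IsCommutativeRing)

-- A finite field of order q = p ^ k (equality is propositional).
-- The inverse is a total function; only its behaviour on non-zero
-- elements is specified.

record FiniteField (p k : ℕ) : Set₁ where
  infixl 6 _+_
  infixl 7 _*_
  field
    F      : Set
    _+_    : F → F → F
    _*_    : F → F → F
    -_     : F → F
    0#     : F
    1#     : F
    _⁻¹    : F → F
    isCommutativeRing : IsCommutativeRing _≡_ _+_ _*_ -_ 0# 1#
    0≢1    : 0# ≢ 1#
    inverseʳ : ∀ x → x ≢ 0# → x * (x ⁻¹) ≡ 1#
    card   : F ↔ Fin (p ^ k)

  _^ᶠ_ : F → ℕ → F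
  x ^ᶠ zero  = 1#
  x ^ᶠ suc n = x * (x ^ᶠ n)

  _^ᶻ_ : F → ℤ → F
  x ^ᶻ (+ n)      = x ^ᶠ n
  x ^ᶻ -[1+ n ]   = (x ⁻¹) ^ᶠ suc n

  IsPrimitive : F → Set
  IsPrimitive ω = ω ≢ 0# × (∀ x → x ≢ 0# → ∃[ n ] ω ^ᶠ n ≡ x)

  φ^ : ℕ → F → F
  φ^ j x = x ^ᶠ (p ^ j)

  Vec2 : Set
  Vec2 = F × F

  zeroV : Vec2
  zeroV = 0# , 0#

  data Mat2 : Set where
    mat : (a b c d : F) → Mat2

  det : Mat2 → F
  det (mat a b c d) = a * d + - (b * c)

  _·_ : Mat2 → Vec2 → Vec2
  mat a b c d · (x , y) = (a * x + b * y) , (c * x + d * y)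

  scal : F → Vec2 → Vec2
  scal s (x , y) = s * x , s * y

  φ^v : ℕ → Vec2 → Vec2
  φ^v j (x , y) = φ^ j x , φ^ j y

  record ΓL : Set where
    constructor ⟨_,_,_⟩
    field
      M       : Mat2
      σ       : Fin k
      nonsing : det M ≢ 0#

  act : ΓL → Vec2 → Vec2
  act g v = ΓL.M g · φ^v (toℕ (ΓL.σ g)) v

  -- identity of group elements (the non-singularity proof is irrelevant)
  _≈Γ_ : ΓL → ΓL → Set
  g ≈Γ h = (ΓL.M g ≡ ΓL.M h) × (ΓL.σ g ≡ ΓL.σ h)

  -- h⁻¹ g fixes the non-zero vector v  iff  g v = h v
  -- derangement graph: g ∼ h iff h⁻¹ g fixes no non-zero vector
  Adj : ΓL → ΓL → Set
  Adj g h = ∀ v → v ≢ zeroV → act g v ≢ act h v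

  E-mat : F → F → Mat2
  E-mat z y = mat 1# z 0# y

  -- g ∈ ω^i φ^j E(y)   (ω^i φ^j M is the map v ↦ ω^i (M v)^{φ^j})
  InωφE : F → ℕ → ℕ → F → ΓL → Set
  InωφE ω i j y g =
    ∃[ z ] (∀ v → act g v ≡ scal (ω ^ᶠ i) (φ^v j (E-mat z y · v)))

  InV : F → ℕ → ℕ → ΓL → Set
  InV ω i j g = ∃[ y ] (y ≢ 0# × InωφE ω i j y g)

  Coclique : (ΓL → Set) → Set
  Coclique S = ∀ g h → S g → S h → ¬ Adj g h

  CompleteBipartite : (ΓL → Set) → (ΓL → Set) → Set
  CompleteBipartite S T =
    (∀ g h → S g → S h → ¬ Adj g h) ×
    (∀ g h → T g → T h → ¬ Adj g h) ×
    (∀ g h → S g → T h → Adj g h)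

  InducedIso : (ΓL → Set) → (X : Set) → (X → X → Set) → Set
  InducedIso S X R =
    Σ (X → ΓL) λ f →
      (∀ x x' → f x ≈Γ f x' → x ≡ x') ×
      (∀ x → S (f x)) ×
      (∀ g → S g → ∃[ x ] f x ≈Γ g) ×
      (∀ x x' → (R x x' → Adj (f x) (f x')) × (Adj (f x) (f x') → R x x'))

_∪_ : {A : Set} → (A → Set) → (A → Set) → A → Set
(S ∪ T) a = S a ⊎ T a

K̄-adj : (n : ℕ) → Fin n → Fin n → Set
K̄-adj n _ _ = ⊥

-- K̃_n^t : vertices (part a , index x); K_n^t with the edges of the n
-- vertex-disjoint copies of K_t {(a , x) : a ∈ Fin t} (x fixed) deleted
K̃-adj : (n t : ℕ) → Fin t × Fin n → Fin t × Fin n → Set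
K̃-adj n t (a , x) (b , y) = a ≢ b × x ≢ y

Lex : {X Y : Set} → (X → X → Set) → (Y → Y → Set) → X × Y → X × Y → Set
Lex R S (x , y) (x' , y') = R x x' ⊎ (x ≡ x' × S y y')

-- An element of ω^i φ^j E(y) acts as v ↦ φ^j (u_i E(z,y) v) with u_i = ω^(i p^(k-j)), because φ^j is a
-- field automorphism (additive since p divides the middle binomial coefficients, bijective since x^q = x).
-- Two such maps with the same j agree on a non-zero vector iff the upper triangular matrix
-- u₁ E(z₁,y₁) - u₂ E(z₂,y₂) is singular, i.e. iff u₁ = u₂ or u₁ y₁ = u₂ y₂. So each coset is a coclique,
-- and for i ≠ i' elements of ω^i φ^j E(y) and ω^i' φ^j E(y') are adjacent iff u_i y ≠ u_i' y', i.e. iff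
-- y' ≠ y ω^((i-i') p^(k-j)). Labelling V_{i,j} ∪ V_{i',j} by (part, x, z), with y = ω^x in the first
-- part and y = ω^((i-i') p^(k-j)) ω^x in the second, two vertices are adjacent iff they differ in both
-- part and x, which is the adjacency of K̃_{q-1}^2[K̄_q].

module Submission where

open import Data.Nat as ℕ using (ℕ; zero; suc; _^_; _∸_; _<_; _≤_; z≤n; s≤s; NonZero)
import Data.Nat.Properties as ℕ
open import Data.Nat.DivMod using (_%_; _/_; m≡m%n+[m/n]*n; m%n<n)
open import Data.Nat.Combinatorics using (_C_; nCk+nC[k+1]≡[n+1]C[k+1]; nC1≡n; nCn≡1)
open import Data.Nat.Combinatorics.Specification using (k>n⇒nCk≡0)
open import Data.Nat.Divisibility using (_∣_; divides; >⇒∤)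
open import Data.Nat.Primality using (Prime; euclidsLemma; prime⇒nonZero; prime⇒nonTrivial)
open import Data.Sum using (_⊎_; inj₁; inj₂)
open import Data.Empty using (⊥-elim)
open import Data.Integer as ℤ using (_⊖_)
import Data.Integer.Properties as ℤ
open import Data.Fin as Fin using (Fin; toℕ)
import Data.Fin.Properties as Fin
open import Data.Fin.Patterns using (0F; 1F)
open import Data.Fin.Permutation using (Permutation′)
open import Data.Vec.Functional using (tail; init; last)
open import Data.Product using (∃-syntax; _×_; _,_; proj₁; proj₂)
open import Relation.Nullary using (¬_; Dec; yes; no)
open import Relation.Nullary.Decidable using (via-injection; decidable-stable)
open import Relation.Binary.Definitions using (DecidableEquality; tri<; tri≈; tri>)
open import Relation.Binary.PropositionalEquality
open import Function.Bundles using (_↔_; _⇔_; Inverse; Injection; Equivalence; mk↔ₛ′; mk⇔)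
open import Function.Properties.Inverse using (↔⇒↣)
open import Function.Construct.Composition using (_↔-∘_)
open import Function.Construct.Symmetry using (↔-sym)
open import Function.Base using (_∘_)
open import Algebra.Bundles using (CommutativeRing)
open import Defs

[1+k]*[1+n]C[1+k]≡[1+n]*nCk : ∀ n k → suc k ℕ.* (suc n C suc k) ≡ suc n ℕ.* (n C k)
[1+k]*[1+n]C[1+k]≡[1+n]*nCk zero    zero    = refl
[1+k]*[1+n]C[1+k]≡[1+n]*nCk zero    (suc k)
  rewrite k>n⇒nCk≡0 {1} {suc (suc k)} (s≤s (s≤s z≤n)) | k>n⇒nCk≡0 {0} {suc k} (s≤s z≤n) = ℕ.*-zeroʳ k
[1+k]*[1+n]C[1+k]≡[1+n]*nCk (suc n) zero
  rewrite nC1≡n (suc (suc n)) = trans (ℕ.+-identityʳ _) (sym (ℕ.*-identityʳ _))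
[1+k]*[1+n]C[1+k]≡[1+n]*nCk (suc n) (suc k) = begin
  suc (suc k) ℕ.* (suc (suc n) C suc (suc k))
    ≡⟨ cong (suc (suc k) ℕ.*_) (sym (nCk+nC[k+1]≡[n+1]C[k+1] (suc n) (suc k))) ⟩
  suc (suc k) ℕ.* (A ℕ.+ B)
    ≡⟨ ℕ.*-distribˡ-+ (suc (suc k)) A B ⟩
  A ℕ.+ suc k ℕ.* A ℕ.+ suc (suc k) ℕ.* B
    ≡⟨ cong₂ (λ u w → A ℕ.+ u ℕ.+ w) ([1+k]*[1+n]C[1+k]≡[1+n]*nCk n k) ([1+k]*[1+n]C[1+k]≡[1+n]*nCk n (suc k)) ⟩
  A ℕ.+ suc n ℕ.* (n C k) ℕ.+ suc n ℕ.* (n C suc k)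
    ≡⟨ ℕ.+-assoc A _ _ ⟩
  A ℕ.+ (suc n ℕ.* (n C k) ℕ.+ suc n ℕ.* (n C suc k))
    ≡⟨ cong (A ℕ.+_) (sym (ℕ.*-distribˡ-+ (suc n) (n C k) (n C suc k))) ⟩
  A ℕ.+ suc n ℕ.* (n C k ℕ.+ n C suc k)
    ≡⟨ cong (λ w → A ℕ.+ suc n ℕ.* w) (nCk+nC[k+1]≡[n+1]C[k+1] n k) ⟩
  suc (suc n) ℕ.* A ∎
  where
  open ≡-Reasoning
  A = suc n C suc k
  B = suc n C suc (suc k)

p∣pCk : ∀ {p k} → Prime p → 0 < k → k < p → p ∣ p C k
p∣pCk {suc p} {suc k} p-prime _ k<p
  with euclidsLemma (suc k) (suc p C suc k) p-prime
         (divides (p C k) (trans ([1+k]*[1+n]C[1+k]≡[1+n]*nCk p k) (ℕ.*-comm (suc p) (p C k))))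
... | inj₁ p∣k   = ⊥-elim (>⇒∤ k<p p∣k)
... | inj₂ p∣pCk = p∣pCk

m^n*m^[o∸n]≡m^o : ∀ m {n o} → n ≤ o → m ^ n ℕ.* m ^ (o ∸ n) ≡ m ^ o
m^n*m^[o∸n]≡m^o m {n} {o} n≤o = trans (sym (ℕ.^-distribˡ-+-* m n (o ∸ n))) (cong (m ^_) (ℕ.m+[n∸m]≡n n≤o))

[m-n]*o≡mo⊖no : ∀ m n o → ((ℤ.+ m) ℤ.- (ℤ.+ n)) ℤ.* (ℤ.+ o) ≡ (m ℕ.* o) ⊖ (n ℕ.* o)
[m-n]*o≡mo⊖no m n o = begin
  ((ℤ.+ m) ℤ.- (ℤ.+ n)) ℤ.* (ℤ.+ o)                  ≡⟨ ℤ.*-distribʳ-+ (ℤ.+ o) (ℤ.+ m) (ℤ.- (ℤ.+ n)) ⟩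
  (ℤ.+ m) ℤ.* (ℤ.+ o) ℤ.+ (ℤ.- (ℤ.+ n)) ℤ.* (ℤ.+ o)
    ≡⟨ cong (λ w → (ℤ.+ m) ℤ.* (ℤ.+ o) ℤ.+ w) (sym (ℤ.neg-distribˡ-* (ℤ.+ n) (ℤ.+ o))) ⟩
  (ℤ.+ m) ℤ.* (ℤ.+ o) ℤ.- (ℤ.+ n) ℤ.* (ℤ.+ o)        ≡⟨ cong₂ ℤ._-_ (sym (ℤ.pos-* m o)) (sym (ℤ.pos-* n o)) ⟩
  (ℤ.+ (m ℕ.* o)) ℤ.- (ℤ.+ (n ℕ.* o))                ≡⟨ ℤ.m-n≡m⊖n (m ℕ.* o) (n ℕ.* o) ⟩
  (m ℕ.* o) ⊖ (n ℕ.* o)                              ∎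
  where open ≡-Reasoning

module FiniteFieldProperties {p k : ℕ} (FF : FiniteField p k) where
  open FiniteField FF

  commutativeRing : CommutativeRing _ _
  commutativeRing = record { isCommutativeRing = isCommutativeRing }

  open CommutativeRing commutativeRing public
    using (+-assoc; +-comm; *-assoc; *-comm; zeroˡ; zeroʳ; distribʳ;
           +-identityˡ; +-identityʳ; *-identityˡ; *-identityʳ; -‿inverseˡ; -‿inverseʳ)
  open CommutativeRing commutativeRing using (ring; semiring; commutativeSemiring; +-commutativeMonoid)
  open import Algebra.Properties.Ring ring public using (-0#≈0#; +-identityʳ-unique; x∙y⁻¹≈ε⇒x≈y)
  open import Algebra.Properties.Semiring.Mult semiring public using (×1-homo-*; ×-assoc-*)
    renaming (_×_ to _×ₙ_)
  open import Algebra.Properties.Semiring.Exp semiring using (^-homo-*; ^-assocʳ) renaming (_^_ to _^ʳ_)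
  open import Algebra.Properties.CommutativeSemiring.Exp commutativeSemiring using (^-distrib-*)
  open import Algebra.Properties.CommutativeMonoid.Sum +-commutativeMonoid
    using (sum; sum-permute; ∑-distrib-+; sum-replicate; sum-replicate-zero; sum-cong-≗; sum-init-last)
  import Algebra.Properties.CommutativeSemiring.Binomial commutativeSemiring as Binomial
  open import Algebra.Solver.Ring.NaturalCoefficients.Default commutativeSemiring public
    using (solve; _:=_; _:+_; _:*_; con)

  1≢0 : 1# ≢ 0#
  1≢0 1≡0 = 0≢1 (sym 1≡0)

  x⁻¹*x≡1 : ∀ {x} → x ≢ 0# → x ⁻¹ * x ≡ 1#
  x⁻¹*x≡1 {x} x≢0 = trans (*-comm _ _) (inverseʳ x x≢0)

  *-cancelˡ-≢0 : ∀ {a b c} → a ≢ 0# → a * b ≡ a * c → b ≡ c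
  *-cancelˡ-≢0 {a} {b} {c} a≢0 ab≡ac = begin
    b                ≡⟨ sym (*-identityˡ b) ⟩
    1# * b           ≡⟨ cong (_* b) (sym (x⁻¹*x≡1 a≢0)) ⟩
    (a ⁻¹ * a) * b   ≡⟨ *-assoc _ _ _ ⟩
    a ⁻¹ * (a * b)   ≡⟨ cong (a ⁻¹ *_) ab≡ac ⟩
    a ⁻¹ * (a * c)   ≡⟨ sym (*-assoc _ _ _) ⟩
    (a ⁻¹ * a) * c   ≡⟨ cong (_* c) (x⁻¹*x≡1 a≢0) ⟩
    1# * c           ≡⟨ *-identityˡ c ⟩
    c                ∎
    where open ≡-Reasoning

  *-cancelʳ-≢0 : ∀ {a b c} → a ≢ 0# → b * a ≡ c * a → b ≡ c
  *-cancelʳ-≢0 {a} {b} {c} a≢0 ba≡ca = *-cancelˡ-≢0 a≢0 (trans (*-comm a b) (trans ba≡ca (*-comm c a)))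

  x*y≢0 : ∀ {x y} → x ≢ 0# → y ≢ 0# → x * y ≢ 0#
  x*y≢0 {x} {y} x≢0 y≢0 xy≡0 = y≢0 (*-cancelˡ-≢0 x≢0 (trans xy≡0 (sym (zeroʳ x))))

  infix 4 _≟_
  _≟_ : DecidableEquality F
  _≟_ = via-injection (↔⇒↣ card) Fin._≟_


  ^ᶠ≗^ʳ : ∀ x n → x ^ᶠ n ≡ x ^ʳ n
  ^ᶠ≗^ʳ x zero    = refl
  ^ᶠ≗^ʳ x (suc n) = cong (x *_) (^ᶠ≗^ʳ x n)

  ^ᶠ-+ : ∀ x m n → x ^ᶠ (m ℕ.+ n) ≡ x ^ᶠ m * x ^ᶠ n
  ^ᶠ-+ x m n rewrite ^ᶠ≗^ʳ x (m ℕ.+ n) | ^ᶠ≗^ʳ x m | ^ᶠ≗^ʳ x n = ^-homo-* x m n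

  ^ᶠ-* : ∀ x m n → (x ^ᶠ m) ^ᶠ n ≡ x ^ᶠ (m ℕ.* n)
  ^ᶠ-* x m n rewrite ^ᶠ≗^ʳ x m | ^ᶠ≗^ʳ (x ^ʳ m) n | ^ᶠ≗^ʳ x (m ℕ.* n) = ^-assocʳ x m n

  *-^ᶠ : ∀ x y n → (x * y) ^ᶠ n ≡ x ^ᶠ n * y ^ᶠ n
  *-^ᶠ x y n rewrite ^ᶠ≗^ʳ (x * y) n | ^ᶠ≗^ʳ x n | ^ᶠ≗^ʳ y n = ^-distrib-* x y n

  1^ᶠn≡1 : ∀ n → 1# ^ᶠ n ≡ 1#
  1^ᶠn≡1 zero    = refl
  1^ᶠn≡1 (suc n) = trans (*-identityˡ _) (1^ᶠn≡1 n)

  x^ᶠn≢0 : ∀ {x} n → x ≢ 0# → x ^ᶠ n ≢ 0#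
  x^ᶠn≢0 zero    x≢0 = 1≢0
  x^ᶠn≢0 (suc n) x≢0 = x*y≢0 x≢0 (x^ᶠn≢0 n x≢0)

  x^ᶠn≡0⇒x≡0 : ∀ {x} n → .{{NonZero n}} → x ^ᶠ n ≡ 0# → x ≡ 0#
  x^ᶠn≡0⇒x≡0 {x} (suc n) xⁿ≡0 with x ≟ 0#
  ... | yes x≡0 = x≡0
  ... | no  x≢0 = ⊥-elim (x^ᶠn≢0 (suc n) x≢0 xⁿ≡0)

  x^d≡1⇒x^n≡x^[n%d] : ∀ {x d} .{{_ : NonZero d}} → x ^ᶠ d ≡ 1# → ∀ n → x ^ᶠ n ≡ x ^ᶠ (n % d)
  x^d≡1⇒x^n≡x^[n%d] {x} {d} xᵈ≡1 n = begin
    x ^ᶠ n                                  ≡⟨ cong (x ^ᶠ_) (m≡m%n+[m/n]*n n d) ⟩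
    x ^ᶠ (n % d ℕ.+ (n / d) ℕ.* d)          ≡⟨ ^ᶠ-+ x (n % d) _ ⟩
    x ^ᶠ (n % d) * x ^ᶠ ((n / d) ℕ.* d)     ≡⟨ cong (λ m → x ^ᶠ (n % d) * x ^ᶠ m) (ℕ.*-comm (n / d) d) ⟩
    x ^ᶠ (n % d) * x ^ᶠ (d ℕ.* (n / d))     ≡⟨ cong (x ^ᶠ (n % d) *_) (sym (^ᶠ-* x d (n / d))) ⟩
    x ^ᶠ (n % d) * (x ^ᶠ d) ^ᶠ (n / d)      ≡⟨ cong (λ w → x ^ᶠ (n % d) * w ^ᶠ (n / d)) xᵈ≡1 ⟩
    x ^ᶠ (n % d) * 1# ^ᶠ (n / d)            ≡⟨ cong (x ^ᶠ (n % d) *_) (1^ᶠn≡1 (n / d)) ⟩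
    x ^ᶠ (n % d) * 1#                       ≡⟨ *-identityʳ _ ⟩
    x ^ᶠ (n % d)                            ∎
    where open ≡-Reasoning

  x^a≡x^b⇒x^[b∸a]≡1 : ∀ {x a b} → x ≢ 0# → a ≤ b → x ^ᶠ a ≡ x ^ᶠ b → x ^ᶠ (b ∸ a) ≡ 1#
  x^a≡x^b⇒x^[b∸a]≡1 {x} {a} {b} x≢0 a≤b xᵃ≡xᵇ = sym (*-cancelˡ-≢0 (x^ᶠn≢0 a x≢0) (begin
    x ^ᶠ a * 1#              ≡⟨ *-identityʳ _ ⟩
    x ^ᶠ a                   ≡⟨ xᵃ≡xᵇ ⟩
    x ^ᶠ b                   ≡⟨ cong (x ^ᶠ_) (sym (ℕ.m+[n∸m]≡n a≤b)) ⟩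
    x ^ᶠ (a ℕ.+ (b ∸ a))     ≡⟨ ^ᶠ-+ x a (b ∸ a) ⟩
    x ^ᶠ a * x ^ᶠ (b ∸ a)    ∎))
    where open ≡-Reasoning

  q-1 : ℕ
  q-1 = p ^ k ∸ 1

  q≡1+[q-1] : p ^ k ≡ suc q-1
  q≡1+[q-1] = sym (ℕ.m+[n∸m]≡n (ℕ.>-nonZero⁻¹ _ {{Fin.nonZeroIndex (Inverse.to card 0#)}}))

  open Inverse card public using () renaming (to to index; from to element; strictlyInverseʳ to element-index)

  element-injective : ∀ {s t} → element s ≡ element t → s ≡ t
  element-injective = Injection.injective (↔⇒↣ (↔-sym card))

  injection⇒q≤ : ∀ {m} (f : F → Fin m) → (∀ {x y} → f x ≡ f y → x ≡ y) → p ^ k ≤ m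
  injection⇒q≤ f f-injective = Fin.injective⇒≤ (λ fs≡ft → element-injective (f-injective fs≡ft))

  card′ : F ↔ Fin (suc q-1)
  card′ = subst (λ n → F ↔ Fin n) q≡1+[q-1] card

  index′ : F → Fin (suc q-1)
  index′ = Inverse.to card′

  index′-injective : ∀ {x y} → index′ x ≡ index′ y → x ≡ y
  index′-injective = Injection.injective (↔⇒↣ card′)

  instance
    q-1≢0 : NonZero q-1
    q-1≢0 = Fin.nonZeroIndex (Fin.punchOut {i = index′ 0#} {j = index′ 1#} (λ eq → 0≢1 (index′-injective eq)))

  pigeonhole-F* : (f : Fin (suc q-1) → F) → (∀ t → f t ≢ 0#) → ∃[ a ] ∃[ b ] a Fin.< b × f a ≡ f b
  pigeonhole-F* f f≢0
    with Fin.pigeonhole (ℕ.n<1+n q-1) (λ t → Fin.punchOut (λ eq → f≢0 t (sym (index′-injective eq))))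
  ... | a , b , a<b , eq = a , b , a<b , index′-injective (Fin.punchOut-injective {i = index′ 0#} _ _ eq)

  [x+-y]+y≡x : ∀ x y → (x + - y) + y ≡ x
  [x+-y]+y≡x x y = trans (+-assoc x (- y) y) (trans (cong (x +_) (-‿inverseˡ y)) (+-identityʳ x))

  [x+y]+-y≡x : ∀ x y → (x + y) + - y ≡ x
  [x+y]+-y≡x x y = trans (+-assoc x y (- y)) (trans (cong (x +_) (-‿inverseʳ y)) (+-identityʳ x))

  q×1≡0 : (p ^ k) ×ₙ 1# ≡ 0#
  q×1≡0 = +-identityʳ-unique Σx ((p ^ k) ×ₙ 1#) (sym (begin
    Σx                                            ≡⟨ sum-permute element π ⟩
    sum (λ t → element (index (element t + 1#)))  ≡⟨ sum-cong-≗ (λ t → element-index (element t + 1#)) ⟩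
    sum (λ t → element t + 1#)                    ≡⟨ ∑-distrib-+ element (λ _ → 1#) ⟩
    Σx + sum {p ^ k} (λ _ → 1#)                   ≡⟨ cong (Σx +_) (sum-replicate (p ^ k)) ⟩
    Σx + (p ^ k) ×ₙ 1#                            ∎))
    where
    open ≡-Reasoning
    Σx : F
    Σx = sum element
    translation : F ↔ F
    translation = mk↔ₛ′ (_+ 1#) (_+ - 1#) (λ x → [x+-y]+y≡x x 1#) (λ x → [x+y]+-y≡x x 1#)
    π : Permutation′ (p ^ k)
    π = card ↔-∘ (translation ↔-∘ ↔-sym card)

  [m^n]×1≡[m×1]^n : ∀ m n → (m ^ n) ×ₙ 1# ≡ (m ×ₙ 1#) ^ᶠ n
  [m^n]×1≡[m×1]^n m zero    = +-identityʳ 1#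
  [m^n]×1≡[m×1]^n m (suc n) = trans (×1-homo-* m (m ^ n)) (cong ((m ×ₙ 1#) *_) ([m^n]×1≡[m×1]^n m n))

  x^ᶻ-neg : ∀ x d → x ^ᶻ (ℤ.- (ℤ.+ d)) ≡ (x ⁻¹) ^ᶠ d
  x^ᶻ-neg x zero    = refl
  x^ᶻ-neg x (suc d) = refl

  x^ᶻ[m⊖n]*x^n≡x^m : ∀ {x} → x ≢ 0# → ∀ m n → x ^ᶻ (m ⊖ n) * x ^ᶠ n ≡ x ^ᶠ m
  x^ᶻ[m⊖n]*x^n≡x^m {x} x≢0 m n with n ℕ.≤? m
  ... | yes n≤m = begin
    x ^ᶻ (m ⊖ n) * x ^ᶠ n        ≡⟨ cong (λ z → x ^ᶻ z * x ^ᶠ n) (ℤ.⊖-≥ n≤m) ⟩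
    x ^ᶠ (m ∸ n) * x ^ᶠ n        ≡⟨ sym (^ᶠ-+ x (m ∸ n) n) ⟩
    x ^ᶠ (m ∸ n ℕ.+ n)           ≡⟨ cong (x ^ᶠ_) (ℕ.m∸n+n≡m n≤m) ⟩
    x ^ᶠ m                       ∎
    where open ≡-Reasoning
  ... | no  n≰m = begin
    x ^ᶻ (m ⊖ n) * x ^ᶠ n             ≡⟨ cong (λ z → x ^ᶻ z * x ^ᶠ n) (ℤ.⊖-< m<n) ⟩
    x ^ᶻ (ℤ.- (ℤ.+ d)) * x ^ᶠ n         ≡⟨ cong (_* x ^ᶠ n) (x^ᶻ-neg x d) ⟩
    (x ⁻¹) ^ᶠ d * x ^ᶠ n              ≡⟨ cong (λ l → (x ⁻¹) ^ᶠ d * x ^ᶠ l) (sym (ℕ.m∸n+n≡m (ℕ.<⇒≤ m<n))) ⟩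
    (x ⁻¹) ^ᶠ d * x ^ᶠ (d ℕ.+ m)      ≡⟨ cong ((x ⁻¹) ^ᶠ d *_) (^ᶠ-+ x d m) ⟩
    (x ⁻¹) ^ᶠ d * (x ^ᶠ d * x ^ᶠ m)   ≡⟨ sym (*-assoc _ _ _) ⟩
    ((x ⁻¹) ^ᶠ d * x ^ᶠ d) * x ^ᶠ m   ≡⟨ cong (_* x ^ᶠ m) (sym (*-^ᶠ (x ⁻¹) x d)) ⟩
    (x ⁻¹ * x) ^ᶠ d * x ^ᶠ m          ≡⟨ cong (λ w → w ^ᶠ d * x ^ᶠ m) (x⁻¹*x≡1 x≢0) ⟩
    1# ^ᶠ d * x ^ᶠ m                  ≡⟨ cong (_* x ^ᶠ m) (1^ᶠn≡1 d) ⟩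
    1# * x ^ᶠ m                       ≡⟨ *-identityˡ _ ⟩
    x ^ᶠ m                            ∎
    where
    open ≡-Reasoning
    m<n = ℕ.≰⇒> n≰m
    d = n ∸ m

  φ^-* : ∀ j a b → φ^ j (a * b) ≡ φ^ j a * φ^ j b
  φ^-* j a b = *-^ᶠ a b (p ^ j)

  φ^-1 : ∀ j → φ^ j 1# ≡ 1#
  φ^-1 j = 1^ᶠn≡1 (p ^ j)

  module Frobenius (p-prime : Prime p) (1≤k : 1 ≤ k) where

    instance
      p≢0 : NonZero p
      p≢0 = prime⇒nonZero p-prime

    p×1≡0 : p ×ₙ 1# ≡ 0#
    p×1≡0 = x^ᶠn≡0⇒x≡0 k {{ℕ.>-nonZero 1≤k}}
      (trans (sym ([m^n]×1≡[m×1]^n p k)) q×1≡0)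

    p∣n⇒n×x≡0 : ∀ {n} x → p ∣ n → n ×ₙ x ≡ 0#
    p∣n⇒n×x≡0 x (divides c refl) = begin
      (c ℕ.* p) ×ₙ x                      ≡⟨ cong ((c ℕ.* p) ×ₙ_) (sym (*-identityˡ x)) ⟩
      (c ℕ.* p) ×ₙ (1# * x)               ≡⟨ sym (×-assoc-* (c ℕ.* p) 1# x) ⟩
      ((c ℕ.* p) ×ₙ 1#) * x               ≡⟨ cong (_* x) (×1-homo-* c p) ⟩
      ((c ×ₙ 1#) * (p ×ₙ 1#)) * x         ≡⟨ cong (λ w → ((c ×ₙ 1#) * w) * x) p×1≡0 ⟩
      ((c ×ₙ 1#) * 0#) * x                ≡⟨ cong (_* x) (zeroʳ _) ⟩
      0# * x                              ≡⟨ zeroˡ x ⟩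
      0#                                  ∎
      where open ≡-Reasoning

    [a+b]^n≡a^n+b^n : ∀ n → .{{NonZero n}} → (∀ m → 0 < m → m < n → p ∣ n C m) →
                      ∀ a b → (a + b) ^ᶠ n ≡ a ^ᶠ n + b ^ᶠ n
    [a+b]^n≡a^n+b^n n@(suc r) p∣middle a b = begin
      (a + b) ^ᶠ n                                  ≡⟨ ^ᶠ≗^ʳ (a + b) n ⟩
      (a + b) ^ʳ n                                  ≡⟨ Binomial.theorem n a b ⟩
      sum term                                      ≡⟨⟩
      term Fin.zero + sum (tail term)               ≡⟨ cong (term Fin.zero +_) (sum-init-last (tail term)) ⟩
      term Fin.zero + (sum (init (tail term)) + last (tail term))
        ≡⟨ cong (λ w → term Fin.zero + (w + last (tail term))) middle≡0 ⟩
      term Fin.zero + (0# + last (tail term))       ≡⟨ cong₂ _+_ first≡bⁿ (trans (+-identityˡ _) last≡aⁿ) ⟩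
      b ^ᶠ n + a ^ᶠ n                               ≡⟨ +-comm _ _ ⟩
      a ^ᶠ n + b ^ᶠ n                               ∎
      where
      open ≡-Reasoning
      term : Fin (suc n) → F
      term = Binomial.binomialTerm a b n
      middle≡0 : sum (init (tail term)) ≡ 0#
      middle≡0 = trans (sum-cong-≗ (λ i → p∣n⇒n×x≡0 _ (p∣middle (suc (toℕ (Fin.inject₁ i))) (s≤s z≤n)
                                               (s≤s (subst (_< r) (sym (Fin.toℕ-inject₁ i)) (Fin.toℕ<n i))))))
                       (sum-replicate-zero r)
      first≡bⁿ : term Fin.zero ≡ b ^ᶠ n
      first≡bⁿ = trans (+-identityʳ _) (trans (*-identityˡ _) (sym (^ᶠ≗^ʳ b n)))
      last≡aⁿ : last (tail term) ≡ a ^ᶠ n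
      last≡aⁿ = begin
        (n C toℕ (Fin.fromℕ n)) ×ₙ (a ^ʳ toℕ (Fin.fromℕ n) * b ^ʳ (n ∸ toℕ (Fin.fromℕ n)))
          ≡⟨ cong (λ m → (n C m) ×ₙ (a ^ʳ m * b ^ʳ (n ∸ m))) (Fin.toℕ-fromℕ n) ⟩
        (n C n) ×ₙ (a ^ʳ n * b ^ʳ (n ∸ n))
          ≡⟨ cong₂ (λ c m → c ×ₙ (a ^ʳ n * b ^ʳ m)) (nCn≡1 n) (ℕ.n∸n≡0 n) ⟩
        1 ×ₙ (a ^ʳ n * 1#)      ≡⟨ trans (+-identityʳ _) (*-identityʳ _) ⟩
        a ^ʳ n                  ≡⟨ sym (^ᶠ≗^ʳ a n) ⟩
        a ^ᶠ n                  ∎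

    [a+b]^p≡a^p+b^p : ∀ a b → (a + b) ^ᶠ p ≡ a ^ᶠ p + b ^ᶠ p
    [a+b]^p≡a^p+b^p = [a+b]^n≡a^n+b^n p (λ m → p∣pCk p-prime)

    φ^-0 : ∀ j → φ^ j 0# ≡ 0#
    φ^-0 j = trans (cong (0# ^ᶠ_) (sym (ℕ.suc-pred (p ^ j) {{ℕ.m^n≢0 p j}}))) (zeroˡ _)

    φ^-+ : ∀ j a b → φ^ j (a + b) ≡ φ^ j a + φ^ j b
    φ^-+ zero    a b = distribʳ 1# a b
    φ^-+ (suc j) a b = begin
      (a + b) ^ᶠ (p ℕ.* p ^ j)                   ≡⟨ sym (^ᶠ-* (a + b) p (p ^ j)) ⟩
      ((a + b) ^ᶠ p) ^ᶠ (p ^ j)                  ≡⟨ cong (_^ᶠ (p ^ j)) ([a+b]^p≡a^p+b^p a b) ⟩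
      (a ^ᶠ p + b ^ᶠ p) ^ᶠ (p ^ j)               ≡⟨ φ^-+ j (a ^ᶠ p) (b ^ᶠ p) ⟩
      (a ^ᶠ p) ^ᶠ (p ^ j) + (b ^ᶠ p) ^ᶠ (p ^ j)  ≡⟨ cong₂ _+_ (^ᶠ-* a p (p ^ j)) (^ᶠ-* b p (p ^ j)) ⟩
      a ^ᶠ (p ℕ.* p ^ j) + b ^ᶠ (p ℕ.* p ^ j)    ∎
      where open ≡-Reasoning

  module PrimitiveElement {ω : F} (ω-primitive : IsPrimitive ω) where

    ω≢0 : ω ≢ 0#
    ω≢0 = proj₁ ω-primitive

    log : ∀ x → x ≢ 0# → ℕ
    log x x≢0 = proj₁ (proj₂ ω-primitive x x≢0)

    ω^log : ∀ x (x≢0 : x ≢ 0#) → ω ^ᶠ log x x≢0 ≡ x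
    ω^log x x≢0 = proj₂ (proj₂ ω-primitive x x≢0)

    ω^d≡1⇒q-1≤d : ∀ d .{{_ : NonZero d}} → ω ^ᶠ d ≡ 1# → q-1 ≤ d
    ω^d≡1⇒q-1≤d d ω^d≡1 = ℕ.∸-monoˡ-≤ 1 (injection⇒q≤ (λ x → residue x (x ≟ 0#)) (residue-injective _ _))
      where
      residue : (x : F) → Dec (x ≡ 0#) → Fin (suc d)
      residue x (yes _)   = Fin.zero
      residue x (no  x≢0) = Fin.suc (Fin.fromℕ< (m%n<n (log x x≢0) d))
      residue-injective : ∀ x y → residue x (x ≟ 0#) ≡ residue y (y ≟ 0#) → x ≡ y
      residue-injective x y eq with x ≟ 0# | y ≟ 0# | eq
      ... | yes x≡0 | yes y≡0 | _ = trans x≡0 (sym y≡0)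
      ... | no  x≢0 | no  y≢0 | eq′ = begin
        x                         ≡⟨ sym (ω^log x x≢0) ⟩
        ω ^ᶠ log x x≢0            ≡⟨ x^d≡1⇒x^n≡x^[n%d] ω^d≡1 _ ⟩
        ω ^ᶠ (log x x≢0 % d)      ≡⟨ cong (ω ^ᶠ_) (Fin.fromℕ<-injective _ _ _ _ (Fin.suc-injective eq′)) ⟩
        ω ^ᶠ (log y y≢0 % d)      ≡⟨ sym (x^d≡1⇒x^n≡x^[n%d] ω^d≡1 _) ⟩
        ω ^ᶠ log y y≢0            ≡⟨ ω^log y y≢0 ⟩
        y                         ∎
        where open ≡-Reasoning

    ω^m≡ω^n⇒q-1≤n∸m : ∀ {m n} → m < n → ω ^ᶠ m ≡ ω ^ᶠ n → q-1 ≤ n ∸ m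
    ω^m≡ω^n⇒q-1≤n∸m m<n ωᵐ≡ωⁿ =
      ω^d≡1⇒q-1≤d _ {{ℕ.>-nonZero (ℕ.m<n⇒0<n∸m m<n)}} (x^a≡x^b⇒x^[b∸a]≡1 ω≢0 (ℕ.<⇒≤ m<n) ωᵐ≡ωⁿ)

    ω^[q-1]≡1 : ω ^ᶠ q-1 ≡ 1#
    ω^[q-1]≡1 with pigeonhole-F* (λ t → ω ^ᶠ toℕ t) (λ t → x^ᶠn≢0 (toℕ t) ω≢0)
    ... | a , b , a<b , ωᵃ≡ωᵇ = subst (λ d → ω ^ᶠ d ≡ 1#) b∸a≡q-1 ω^[b∸a]≡1
      where
      ω^[b∸a]≡1 : ω ^ᶠ (toℕ b ∸ toℕ a) ≡ 1#
      ω^[b∸a]≡1 = x^a≡x^b⇒x^[b∸a]≡1 ω≢0 (ℕ.<⇒≤ a<b) ωᵃ≡ωᵇ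
      b∸a≡q-1 : toℕ b ∸ toℕ a ≡ q-1
      b∸a≡q-1 = ℕ.≤-antisym (ℕ.≤-trans (ℕ.m∸n≤m (toℕ b) (toℕ a)) (ℕ.≤-pred (Fin.toℕ<n b)))
                            (ω^m≡ω^n⇒q-1≤n∸m a<b ωᵃ≡ωᵇ)

    ω^-injective : ∀ {a b} → a < q-1 → b < q-1 → ω ^ᶠ a ≡ ω ^ᶠ b → a ≡ b
    ω^-injective {a} {b} a<q-1 b<q-1 ωᵃ≡ωᵇ with ℕ.<-cmp a b
    ... | tri≈ _ a≡b _ = a≡b
    ... | tri< a<b _ _ = ⊥-elim (ℕ.<⇒≱ b<q-1 (ℕ.≤-trans (ω^m≡ω^n⇒q-1≤n∸m a<b ωᵃ≡ωᵇ) (ℕ.m∸n≤m b a)))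
    ... | tri> _ _ b<a = ⊥-elim (ℕ.<⇒≱ a<q-1 (ℕ.≤-trans (ω^m≡ω^n⇒q-1≤n∸m b<a (sym ωᵃ≡ωᵇ)) (ℕ.m∸n≤m a b)))

    ω^-onto : ∀ y → y ≢ 0# → ∃[ x ] ω ^ᶠ toℕ {q-1} x ≡ y
    ω^-onto y y≢0 = Fin.fromℕ< (m%n<n n q-1) , (begin
      ω ^ᶠ toℕ (Fin.fromℕ< (m%n<n n q-1))   ≡⟨ cong (ω ^ᶠ_) (Fin.toℕ-fromℕ< (m%n<n n q-1)) ⟩
      ω ^ᶠ (n % q-1)                        ≡⟨ sym (x^d≡1⇒x^n≡x^[n%d] ω^[q-1]≡1 n) ⟩
      ω ^ᶠ n                                ≡⟨ ω^log y y≢0 ⟩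
      y                                     ∎)
      where
      open ≡-Reasoning
      n = log y y≢0

    x^q≡x : ∀ x → x ^ᶠ (p ^ k) ≡ x
    x^q≡x x with x ≟ 0#
    ... | yes refl = trans (cong (0# ^ᶠ_) q≡1+[q-1]) (zeroˡ _)
    ... | no  x≢0  = begin
      x ^ᶠ (p ^ k)                    ≡⟨ cong (_^ᶠ (p ^ k)) (sym (ω^log x x≢0)) ⟩
      (ω ^ᶠ n) ^ᶠ (p ^ k)             ≡⟨ ^ᶠ-* ω n (p ^ k) ⟩
      ω ^ᶠ (n ℕ.* p ^ k)              ≡⟨ cong (ω ^ᶠ_) (ℕ.*-comm n (p ^ k)) ⟩
      ω ^ᶠ (p ^ k ℕ.* n)              ≡⟨ sym (^ᶠ-* ω (p ^ k) n) ⟩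
      (ω ^ᶠ (p ^ k)) ^ᶠ n             ≡⟨ cong (_^ᶠ n) ω^q≡ω ⟩
      ω ^ᶠ n                          ≡⟨ ω^log x x≢0 ⟩
      x                               ∎
      where
      open ≡-Reasoning
      n = log x x≢0
      ω^q≡ω : ω ^ᶠ (p ^ k) ≡ ω
      ω^q≡ω = trans (cong (ω ^ᶠ_) q≡1+[q-1]) (trans (cong (ω *_) ω^[q-1]≡1) (*-identityʳ ω))

    φ^[k∸j]∘φ^j≗id : ∀ {j} → j ≤ k → ∀ x → (φ^ j x) ^ᶠ (p ^ (k ∸ j)) ≡ x
    φ^[k∸j]∘φ^j≗id {j} j≤k x = trans (^ᶠ-* x (p ^ j) _) (trans (cong (x ^ᶠ_) (m^n*m^[o∸n]≡m^o p j≤k)) (x^q≡x x))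

    φ^j∘φ^[k∸j]≗id : ∀ {j} → j ≤ k → ∀ x → φ^ j (x ^ᶠ (p ^ (k ∸ j))) ≡ x
    φ^j∘φ^[k∸j]≗id {j} j≤k x = begin
      (x ^ᶠ (p ^ (k ∸ j))) ^ᶠ (p ^ j)     ≡⟨ ^ᶠ-* x (p ^ (k ∸ j)) (p ^ j) ⟩
      x ^ᶠ (p ^ (k ∸ j) ℕ.* p ^ j)
        ≡⟨ cong (x ^ᶠ_) (trans (ℕ.*-comm (p ^ (k ∸ j)) (p ^ j)) (m^n*m^[o∸n]≡m^o p j≤k)) ⟩
      x ^ᶠ (p ^ k)                        ≡⟨ x^q≡x x ⟩
      x                                   ∎
      where open ≡-Reasoning

    φ^-injective : ∀ {j} → j ≤ k → ∀ {a b} → φ^ j a ≡ φ^ j b → a ≡ b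
    φ^-injective {j} j≤k {a} {b} φa≡φb =
      trans (sym (φ^[k∸j]∘φ^j≗id j≤k a)) (trans (cong (_^ᶠ (p ^ (k ∸ j))) φa≡φb) (φ^[k∸j]∘φ^j≗id j≤k b))

  scaledE : F → F → F → Vec2 → Vec2
  scaledE u z y v = scal u (E-mat z y · v)

  E-mat·e₁ : ∀ z y → E-mat z y · (1# , 0#) ≡ (1# , 0#)
  E-mat·e₁ z y = cong₂ _,_ (solve 1 (λ z → con 1 :* con 1 :+ z :* con 0 := con 1) refl z)
                           (solve 1 (λ y → con 0 :* con 1 :+ y :* con 0 := con 0) refl y)

  e₁≢0 : (1# , 0#) ≢ zeroV
  e₁≢0 eq = 1≢0 (cong proj₁ eq)

  scaledE-agree-on-e₁ : ∀ {u₁ u₂} z₁ z₂ {y₁ y₂} → u₁ ≡ u₂ →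
                        scaledE u₁ z₁ y₁ (1# , 0#) ≡ scaledE u₂ z₂ y₂ (1# , 0#)
  scaledE-agree-on-e₁ {u₁} z₁ z₂ {y₁} {y₂} refl = cong (scal u₁) (trans (E-mat·e₁ z₁ y₁) (sym (E-mat·e₁ z₂ y₂)))

  -- If u₁ ≢ u₂ the common vector is (u₂ z₂ − u₁ z₁ , u₁ − u₂), read off from the first row.
  scaledE-agree⇐ : ∀ {u₁ u₂} z₁ z₂ {y₁ y₂} → u₁ ≡ u₂ ⊎ u₁ * y₁ ≡ u₂ * y₂ →
                   ∃[ v ] v ≢ zeroV × scaledE u₁ z₁ y₁ v ≡ scaledE u₂ z₂ y₂ v
  scaledE-agree⇐ z₁ z₂ (inj₁ u₁≡u₂) = (1# , 0#) , e₁≢0 , scaledE-agree-on-e₁ z₁ z₂ u₁≡u₂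
  scaledE-agree⇐ {u₁} {u₂} z₁ z₂ {y₁} {y₂} (inj₂ u₁y₁≡u₂y₂) with u₁ ≟ u₂
  ... | yes u₁≡u₂ = (1# , 0#) , e₁≢0 , scaledE-agree-on-e₁ z₁ z₂ u₁≡u₂
  ... | no  u₁≢u₂ = (c , d) , (λ eq → d≢0 (cong proj₂ eq)) , cong₂ _,_ first-row second-row
    where
    open ≡-Reasoning
    c d : F
    c = u₂ * z₂ + - (u₁ * z₁)
    d = u₁ + - u₂
    d≢0 : d ≢ 0#
    d≢0 d≡0 = u₁≢u₂ (x∙y⁻¹≈ε⇒x≈y u₁ u₂ d≡0)
    -- u₁ = u₂ + d and u₂ z₂ = c + u₁ z₁ turn the claim into a semiring identity.
    first-row : u₁ * (1# * c + z₁ * d) ≡ u₂ * (1# * c + z₂ * d)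
    first-row = sym (begin
      u₂ * (1# * c + z₂ * d)
        ≡⟨ solve 4 (λ u z c d → u :* (con 1 :* c :+ z :* d) := u :* c :+ (u :* z) :* d) refl u₂ z₂ c d ⟩
      u₂ * c + (u₂ * z₂) * d          ≡⟨ cong (λ w → u₂ * c + w * d) (sym ([x+-y]+y≡x (u₂ * z₂) (u₁ * z₁))) ⟩
      u₂ * c + (c + u₁ * z₁) * d
        ≡⟨ solve 5 (λ u₂ c d u₁ z₁ → u₂ :* c :+ (c :+ u₁ :* z₁) :* d := (d :+ u₂) :* c :+ u₁ :* z₁ :* d)
                   refl u₂ c d u₁ z₁ ⟩
      (d + u₂) * c + u₁ * z₁ * d      ≡⟨ cong (λ w → w * c + u₁ * z₁ * d) ([x+-y]+y≡x u₁ u₂) ⟩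
      u₁ * c + u₁ * z₁ * d
        ≡⟨ solve 4 (λ u z c d → u :* c :+ u :* z :* d := u :* (con 1 :* c :+ z :* d)) refl u₁ z₁ c d ⟩
      u₁ * (1# * c + z₁ * d)          ∎)
    second-row : u₁ * (0# * c + y₁ * d) ≡ u₂ * (0# * c + y₂ * d)
    second-row = begin
      u₁ * (0# * c + y₁ * d)   ≡⟨ solve 4 (λ u y c d → u :* (con 0 :* c :+ y :* d) := (u :* y) :* d) refl u₁ y₁ c d ⟩
      (u₁ * y₁) * d            ≡⟨ cong (_* d) u₁y₁≡u₂y₂ ⟩
      (u₂ * y₂) * d            ≡⟨ solve 4 (λ u y c d → (u :* y) :* d := u :* (con 0 :* c :+ y :* d)) refl u₂ y₂ c d ⟩
      u₂ * (0# * c + y₂ * d)   ∎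

  scaledE-agree⇒ : ∀ {u₁ u₂ z₁ z₂ y₁ y₂} v → v ≢ zeroV → scaledE u₁ z₁ y₁ v ≡ scaledE u₂ z₂ y₂ v →
                   u₁ ≡ u₂ ⊎ u₁ * y₁ ≡ u₂ * y₂
  scaledE-agree⇒ {u₁} {u₂} {z₁} {z₂} {y₁} {y₂} (v₁ , v₂) v≢0 agree with v₂ ≟ 0# | v₁ ≟ 0#
  ... | no v₂≢0 | _ = inj₂ (*-cancelʳ-≢0 v₂≢0 (begin
    (u₁ * y₁) * v₂             ≡⟨ solve 4 (λ u y v w → (u :* y) :* v := u :* (con 0 :* w :+ y :* v)) refl u₁ y₁ v₂ v₁ ⟩
    u₁ * (0# * v₁ + y₁ * v₂)   ≡⟨ cong proj₂ agree ⟩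
    u₂ * (0# * v₁ + y₂ * v₂)   ≡⟨ solve 4 (λ u y v w → u :* (con 0 :* w :+ y :* v) := (u :* y) :* v) refl u₂ y₂ v₂ v₁ ⟩
    (u₂ * y₂) * v₂             ∎))
    where open ≡-Reasoning
  ... | yes refl | yes refl = ⊥-elim (v≢0 refl)
  ... | yes refl | no v₁≢0 = inj₁ (*-cancelʳ-≢0 v₁≢0 (begin
    u₁ * v₁                    ≡⟨ solve 3 (λ u z v → u :* v := u :* (con 1 :* v :+ z :* con 0)) refl u₁ z₁ v₁ ⟩
    u₁ * (1# * v₁ + z₁ * 0#)   ≡⟨ cong proj₁ agree ⟩
    u₂ * (1# * v₁ + z₂ * 0#)   ≡⟨ solve 3 (λ u z v → u :* (con 1 :* v :+ z :* con 0) := u :* v) refl u₂ z₂ v₁ ⟩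
    u₂ * v₁                    ∎))
    where open ≡-Reasoning

module DerangementGraph {p k : ℕ} (p-prime : Prime p) (1≤k : 1 ≤ k) (FF : FiniteField p k)
                        {ω : FiniteField.F FF} (ω-primitive : FiniteField.IsPrimitive FF ω) where
  open FiniteField FF
  open FiniteFieldProperties FF
  open Frobenius p-prime 1≤k
  open PrimitiveElement ω-primitive

  ω^[p^s]≢ω^[p^t] : ∀ {s t} → s < t → t < k → ω ^ᶠ (p ^ s) ≢ ω ^ᶠ (p ^ t)
  ω^[p^s]≢ω^[p^t] {s} {t} s<t t<k ω^pˢ≡ω^pᵗ = ℕ.<-irrefl refl (begin-strict
    q-1                ≤⟨ ω^m≡ω^n⇒q-1≤n∸m (^-monoʳ-< s<t) ω^pˢ≡ω^pᵗ ⟩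
    p ^ t ∸ p ^ s      <⟨ ℕ.∸-monoʳ-< (ℕ.m^n>0 p s) (ℕ.^-monoʳ-≤ p (ℕ.<⇒≤ s<t)) ⟩
    p ^ t              ≤⟨ ℕ.∸-monoˡ-≤ 1 (^-monoʳ-< t<k) ⟩
    q-1                ∎)
    where
    open ℕ.≤-Reasoning
    ^-monoʳ-< : ∀ {m n} → m < n → p ^ m < p ^ n
    ^-monoʳ-< = ℕ.^-monoʳ-< p (ℕ.nonTrivial⇒n>1 p {{prime⇒nonTrivial p-prime}})

  ω^[p^s]-injective : ∀ {s t} → s < k → t < k → ω ^ᶠ (p ^ s) ≡ ω ^ᶠ (p ^ t) → s ≡ t
  ω^[p^s]-injective {s} {t} s<k t<k ω^pˢ≡ω^pᵗ with ℕ.<-cmp s t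
  ... | tri≈ _ s≡t _ = s≡t
  ... | tri< s<t _ _ = ⊥-elim (ω^[p^s]≢ω^[p^t] s<t t<k ω^pˢ≡ω^pᵗ)
  ... | tri> _ _ t<s = ⊥-elim (ω^[p^s]≢ω^[p^t] t<s s<k (sym ω^pˢ≡ω^pᵗ))

  mat·φ^v[x,0] : ∀ a b c d s x → mat a b c d · φ^v s (x , 0#) ≡ (a * φ^ s x , c * φ^ s x)
  mat·φ^v[x,0] a b c d s x = cong₂ _,_ (lemma a b) (lemma c d)
    where
    lemma : ∀ a b → a * φ^ s x + b * φ^ s 0# ≡ a * φ^ s x
    lemma a b = trans (cong (λ w → a * φ^ s x + b * w) (φ^-0 s))
                      (trans (cong (a * φ^ s x +_) (zeroʳ b)) (+-identityʳ _))

  mat·φ^v[0,1] : ∀ a b c d s → mat a b c d · φ^v s (0# , 1#) ≡ (b , d)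
  mat·φ^v[0,1] a b c d s = cong₂ _,_ (lemma a b) (lemma c d)
    where
    lemma : ∀ a b → a * φ^ s 0# + b * φ^ s 1# ≡ b
    lemma a b rewrite φ^-0 s | φ^-1 s = solve 2 (λ a b → a :* con 0 :+ b :* con 1 := b) refl a b

  det≢0⇒a≢0⊎c≢0 : ∀ {a b c d} → det (mat a b c d) ≢ 0# → a ≢ 0# ⊎ c ≢ 0#
  det≢0⇒a≢0⊎c≢0 {a} {b} {c} {d} det≢0 with a ≟ 0# | c ≟ 0#
  ... | no a≢0   | _        = inj₁ a≢0
  ... | yes _    | no c≢0   = inj₂ c≢0
  ... | yes refl | yes refl = ⊥-elim (det≢0 (begin
    0# * d + - (b * 0#)   ≡⟨ cong₂ (λ u w → u + - w) (zeroˡ d) (zeroʳ b) ⟩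
    0# + - 0#             ≡⟨ +-identityˡ _ ⟩
    - 0#                  ≡⟨ -0#≈0# ⟩
    0#                    ∎))
    where open ≡-Reasoning

  act-faithful : ∀ g h → (∀ v → act g v ≡ act h v) → g ≈Γ h
  act-faithful ⟨ mat a b c d , s , det≢0 ⟩ ⟨ mat a′ b′ c′ d′ , s′ , _ ⟩ g≗h =
    cong₂ (λ (a , c) (b , d) → mat a b c d) column₁ column₂ , Fin.toℕ-injective σ≡σ′
    where
    column : ∀ x → (a * φ^ (toℕ s) x , c * φ^ (toℕ s) x) ≡ (a′ * φ^ (toℕ s′) x , c′ * φ^ (toℕ s′) x)
    column x = trans (sym (mat·φ^v[x,0] a b c d (toℕ s) x))
                     (trans (g≗h (x , 0#)) (mat·φ^v[x,0] a′ b′ c′ d′ (toℕ s′) x))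
    column₁ : (a , c) ≡ (a′ , c′)
    column₁ = cong₂ _,_ (cancel-φ1 (cong proj₁ (column 1#))) (cancel-φ1 (cong proj₂ (column 1#)))
      where
      cancel-φ1 : ∀ {u u′} → u * φ^ (toℕ s) 1# ≡ u′ * φ^ (toℕ s′) 1# → u ≡ u′
      cancel-φ1 {u} {u′} eq rewrite φ^-1 (toℕ s) | φ^-1 (toℕ s′) =
        trans (sym (*-identityʳ u)) (trans eq (*-identityʳ u′))
    column₂ : (b , d) ≡ (b′ , d′)
    column₂ = trans (sym (mat·φ^v[0,1] a b c d (toℕ s))) (trans (g≗h (0# , 1#)) (mat·φ^v[0,1] a′ b′ c′ d′ (toℕ s′)))
    -- The Frobenius exponent s is read off the image of (ω , 0#), as a and c are not both 0.
    σ≡σ′ : toℕ s ≡ toℕ s′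
    σ≡σ′ = ω^[p^s]-injective (Fin.toℕ<n s) (Fin.toℕ<n s′) (cancel (det≢0⇒a≢0⊎c≢0 det≢0))
      where
      at-ω : ∀ {u u′} → u ≡ u′ → u * φ^ (toℕ s) ω ≡ u′ * φ^ (toℕ s′) ω → u * ω ^ᶠ (p ^ toℕ s) ≡ u * ω ^ᶠ (p ^ toℕ s′)
      at-ω refl eq = eq
      cancel : a ≢ 0# ⊎ c ≢ 0# → ω ^ᶠ (p ^ toℕ s) ≡ ω ^ᶠ (p ^ toℕ s′)
      cancel (inj₁ a≢0) = *-cancelˡ-≢0 a≢0 (at-ω (cong proj₁ column₁) (cong proj₁ (column ω)))
      cancel (inj₂ c≢0) = *-cancelˡ-≢0 c≢0 (at-ω (cong proj₂ column₁) (cong proj₂ (column ω)))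

  Adj-sym : ∀ {g h} → Adj g h → Adj h g
  Adj-sym adj v v≢0 hv≡gv = adj v v≢0 (sym hv≡gv)

  φ^v-injective : ∀ {j} → j ≤ k → ∀ {v w} → φ^v j v ≡ φ^v j w → v ≡ w
  φ^v-injective j≤k {v₁ , v₂} {w₁ , w₂} eq =
    cong₂ _,_ (φ^-injective j≤k (cong proj₁ eq)) (φ^-injective j≤k (cong proj₂ eq))

  φ^v-E-mat : ∀ j z y v → φ^v j (E-mat z y · v) ≡ E-mat (φ^ j z) (φ^ j y) · φ^v j v
  φ^v-E-mat j z y (v₁ , v₂) =
    cong₂ _,_ (trans (row 1# z) (cong (λ c → c * φ^ j v₁ + φ^ j z * φ^ j v₂) (φ^-1 j)))
              (trans (row 0# y) (cong (λ c → c * φ^ j v₁ + φ^ j y * φ^ j v₂) (φ^-0 j)))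
    where
    row : ∀ a b → φ^ j (a * v₁ + b * v₂) ≡ φ^ j a * φ^ j v₁ + φ^ j b * φ^ j v₂
    row a b = trans (φ^-+ j _ _) (cong₂ _+_ (φ^-* j a v₁) (φ^-* j b v₂))

  scal-E-mat : ∀ A z y w → mat A (A * z) 0# (A * y) · w ≡ scal A (E-mat z y · w)
  scal-E-mat A z y (w₁ , w₂) = cong₂ _,_
    (solve 4 (λ A z w₁ w₂ → A :* w₁ :+ (A :* z) :* w₂ := A :* (con 1 :* w₁ :+ z :* w₂)) refl A z w₁ w₂)
    (solve 4 (λ A y w₁ w₂ → con 0 :* w₁ :+ (A :* y) :* w₂ := A :* (con 0 :* w₁ :+ y :* w₂)) refl A y w₁ w₂)

  mat-injective : ∀ {a b c d a′ b′ c′ d′} → mat a b c d ≡ mat a′ b′ c′ d′ → a ≡ a′ × b ≡ b′ × c ≡ c′ × d ≡ d′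
  mat-injective refl = refl , refl , refl , refl

  module Cosets {j : ℕ} (j<k : j < k) where

    j≤k : j ≤ k
    j≤k = ℕ.<⇒≤ j<k

    P : ℕ
    P = p ^ (k ∸ j)

    -- ωᴾ m is the preimage of ω ^ m under φ ^ j.
    ωᴾ : ℕ → F
    ωᴾ m = ω ^ᶠ (m ℕ.* P)

    φ^j[ωᴾm]≡ω^m : ∀ m → φ^ j (ωᴾ m) ≡ ω ^ᶠ m
    φ^j[ωᴾm]≡ω^m m = trans (cong (φ^ j) (sym (^ᶠ-* ω m P))) (φ^j∘φ^[k∸j]≗id j≤k (ω ^ᶠ m))

    ωᴾ-injective : ∀ {m n} → m < q-1 → n < q-1 → ωᴾ m ≡ ωᴾ n → m ≡ n
    ωᴾ-injective {m} {n} m<q-1 n<q-1 eq =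
      ω^-injective m<q-1 n<q-1 (trans (sym (φ^j[ωᴾm]≡ω^m m)) (trans (cong (φ^ j) eq) (φ^j[ωᴾm]≡ω^m n)))

    scal-φ^v : ∀ i w → scal (ω ^ᶠ i) (φ^v j w) ≡ φ^v j (scal (ωᴾ i) w)
    scal-φ^v i (w₁ , w₂) = cong₂ _,_ (lift w₁) (lift w₂)
      where
      lift : ∀ x → ω ^ᶠ i * φ^ j x ≡ φ^ j (ωᴾ i * x)
      lift x = trans (cong (_* φ^ j x) (sym (φ^j[ωᴾm]≡ω^m i))) (sym (φ^-* j (ωᴾ i) x))

    coset-det≢0 : ∀ {A} z {y} → A ≢ 0# → y ≢ 0# → det (mat A (A * φ^ j z) 0# (A * φ^ j y)) ≢ 0#
    coset-det≢0 {A} z {y} A≢0 y≢0 det≡0 = x*y≢0 A≢0 (x*y≢0 A≢0 (x^ᶠn≢0 (p ^ j) y≢0)) (begin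
      A * (A * φ^ j y)                              ≡⟨ sym (+-identityʳ _) ⟩
      A * (A * φ^ j y) + 0#                         ≡⟨ cong (A * (A * φ^ j y) +_) (sym -0#≈0#) ⟩
      A * (A * φ^ j y) + - 0#                       ≡⟨ cong (λ w → A * (A * φ^ j y) + - w) (sym (zeroʳ _)) ⟩
      A * (A * φ^ j y) + - ((A * φ^ j z) * 0#)      ≡⟨ det≡0 ⟩
      0#                                            ∎)
      where open ≡-Reasoning

    coset-element : ℕ → (z y : F) → y ≢ 0# → ΓL
    coset-element i z y y≢0 =
      ⟨ mat (ω ^ᶠ i) (ω ^ᶠ i * φ^ j z) 0# (ω ^ᶠ i * φ^ j y) , Fin.fromℕ< j<k , coset-det≢0 z (x^ᶠn≢0 i ω≢0) y≢0 ⟩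

    act-coset-element : ∀ i z y y≢0 v → act (coset-element i z y y≢0) v ≡ scal (ω ^ᶠ i) (φ^v j (E-mat z y · v))
    act-coset-element i z y y≢0 v = begin
      mat A (A * φ^ j z) 0# (A * φ^ j y) · φ^v (toℕ (Fin.fromℕ< j<k)) v
        ≡⟨ cong (λ s → mat A (A * φ^ j z) 0# (A * φ^ j y) · φ^v s v) (Fin.toℕ-fromℕ< j<k) ⟩
      mat A (A * φ^ j z) 0# (A * φ^ j y) · φ^v j v   ≡⟨ scal-E-mat A (φ^ j z) (φ^ j y) (φ^v j v) ⟩
      scal A (E-mat (φ^ j z) (φ^ j y) · φ^v j v)     ≡⟨ cong (scal A) (sym (φ^v-E-mat j z y v)) ⟩
      scal A (φ^v j (E-mat z y · v))                 ∎
      where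
      open ≡-Reasoning
      A = ω ^ᶠ i

    coset-element-∈ : ∀ i z y y≢0 → InωφE ω i j y (coset-element i z y y≢0)
    coset-element-∈ i z y y≢0 = z , act-coset-element i z y y≢0

    coset-element-≈ : ∀ {i z y y′ g} (y≢0 : y ≢ 0#) (g∈ : InωφE ω i j y′ g) → z ≡ proj₁ g∈ → y ≡ y′ →
                      coset-element i z y y≢0 ≈Γ g
    coset-element-≈ {i} {z} {y} {g = g} y≢0 (z , g≗) refl refl =
      act-faithful (coset-element i z y y≢0) g (λ v → trans (act-coset-element i z y y≢0 v) (sym (g≗ v)))

    coset-element-injective : ∀ {i₁ i₂ z₁ z₂ y₁ y₂} {y₁≢0 : y₁ ≢ 0#} {y₂≢0 : y₂ ≢ 0#} →
      coset-element i₁ z₁ y₁ y₁≢0 ≈Γ coset-element i₂ z₂ y₂ y₂≢0 → ω ^ᶠ i₁ ≡ ω ^ᶠ i₂ × z₁ ≡ z₂ × y₁ ≡ y₂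
    coset-element-injective {i₁} {i₂} (M≡M′ , _) with mat-injective M≡M′
    ... | ωⁱ¹≡ωⁱ² , b≡b′ , _ , d≡d′ = ωⁱ¹≡ωⁱ² , entry b≡b′ , entry d≡d′
      where
      entry : ∀ {x x′} → ω ^ᶠ i₁ * φ^ j x ≡ ω ^ᶠ i₂ * φ^ j x′ → x ≡ x′
      entry eq = φ^-injective j≤k (*-cancelˡ-≢0 (x^ᶠn≢0 i₁ ω≢0) (trans eq (cong (_* _) (sym ωⁱ¹≡ωⁱ²))))

    act-in-coset : ∀ {i y g} → (g∈ : InωφE ω i j y g) → ∀ v → act g v ≡ φ^v j (scaledE (ωᴾ i) (proj₁ g∈) y v)
    act-in-coset {i} (z , g≗) v = trans (g≗ v) (scal-φ^v i _)

    -- Both maps are φ ^ j of scaled E-matrices, so they agree on v ≢ 0 iff the scaled E-matrices do.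
    adjacent⇔ : ∀ {i₁ i₂ y₁ y₂ g h} → InωφE ω i₁ j y₁ g → InωφE ω i₂ j y₂ h →
                Adj g h ⇔ (¬ (ωᴾ i₁ ≡ ωᴾ i₂ ⊎ ωᴾ i₁ * y₁ ≡ ωᴾ i₂ * y₂))
    adjacent⇔ {i₁} {i₂} {y₁} {y₂} {g} {h} g∈@(z₁ , _) h∈@(z₂ , _) = mk⇔ adjacent⇒ adjacent⇐
      where
      act≡⇔scaledE≡ : ∀ v → act g v ≡ act h v ⇔ scaledE (ωᴾ i₁) z₁ y₁ v ≡ scaledE (ωᴾ i₂) z₂ y₂ v
      act≡⇔scaledE≡ v = mk⇔
        (λ gv≡hv → φ^v-injective j≤k (trans (sym g-linear) (trans gv≡hv h-linear)))
        (λ agree → trans g-linear (trans (cong (φ^v j) agree) (sym h-linear)))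
        where
        g-linear : act g v ≡ φ^v j (scaledE (ωᴾ i₁) z₁ y₁ v)
        g-linear = act-in-coset {i₁} {y₁} {g} g∈ v
        h-linear : act h v ≡ φ^v j (scaledE (ωᴾ i₂) z₂ y₂ v)
        h-linear = act-in-coset {i₂} {y₂} {h} h∈ v
      adjacent⇒ : Adj g h → ¬ (ωᴾ i₁ ≡ ωᴾ i₂ ⊎ ωᴾ i₁ * y₁ ≡ ωᴾ i₂ * y₂)
      adjacent⇒ adj condition with scaledE-agree⇐ z₁ z₂ condition
      ... | v , v≢0 , agree = adj v v≢0 (Equivalence.from (act≡⇔scaledE≡ v) agree)
      adjacent⇐ : ¬ (ωᴾ i₁ ≡ ωᴾ i₂ ⊎ ωᴾ i₁ * y₁ ≡ ωᴾ i₂ * y₂) → Adj g h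
      adjacent⇐ ¬condition v v≢0 gv≡hv = ¬condition (scaledE-agree⇒ v v≢0 (Equivalence.to (act≡⇔scaledE≡ v) gv≡hv))

    same-coset-nonadjacent : ∀ {i y₁ y₂ g h} → InωφE ω i j y₁ g → InωφE ω i j y₂ h → ¬ Adj g h
    same-coset-nonadjacent {i} {y₁} {y₂} {g} {h} g∈ h∈ adj =
      Equivalence.to (adjacent⇔ {i} {i} {y₁} {y₂} {g} {h} g∈ h∈) adj (inj₁ refl)

    module CosetPair {i i′ : ℕ} (i<q-1 : i < q-1) (i′<q-1 : i′ < q-1) (i≢i′ : i ≢ i′) where

      e : F
      e = ω ^ᶻ ((ℤ.+ i ℤ.- ℤ.+ i′) ℤ.* ℤ.+ P)

      e*ωᴾi′≡ωᴾi : e * ωᴾ i′ ≡ ωᴾ i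
      e*ωᴾi′≡ωᴾi = trans (cong (λ n → ω ^ᶻ n * ωᴾ i′) ([m-n]*o≡mo⊖no i i′ P))
                         (x^ᶻ[m⊖n]*x^n≡x^m ω≢0 (i ℕ.* P) (i′ ℕ.* P))

      e≢0 : e ≢ 0#
      e≢0 e≡0 = x^ᶠn≢0 (i ℕ.* P) ω≢0 (trans (sym e*ωᴾi′≡ωᴾi) (trans (cong (_* ωᴾ i′) e≡0) (zeroˡ _)))

      ωᴾ-condition⇐ : ∀ {y y′} → y′ ≡ y * e → ωᴾ i * y ≡ ωᴾ i′ * y′
      ωᴾ-condition⇐ {y} refl = begin
        ωᴾ i * y             ≡⟨ cong (_* y) (sym e*ωᴾi′≡ωᴾi) ⟩
        (e * ωᴾ i′) * y      ≡⟨ solve 3 (λ e u y → (e :* u) :* y := u :* (y :* e)) refl e (ωᴾ i′) y ⟩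
        ωᴾ i′ * (y * e)      ∎
        where open ≡-Reasoning

      ωᴾ-condition⇒ : ∀ {y y′} → ωᴾ i * y ≡ ωᴾ i′ * y′ → y′ ≡ y * e
      ωᴾ-condition⇒ eq = *-cancelˡ-≢0 (x^ᶠn≢0 (i′ ℕ.* P) ω≢0) (trans (sym eq) (ωᴾ-condition⇐ refl))

      cross-adjacent⇔ : ∀ {y y′ g h} → InωφE ω i j y g → InωφE ω i′ j y′ h → Adj g h ⇔ (y′ ≢ y * e)
      cross-adjacent⇔ {y} {y′} {g} {h} g∈ h∈ = mk⇔
        (λ adj y′≡ye → Equivalence.to criterion adj (inj₂ (ωᴾ-condition⇐ y′≡ye)))
        (λ y′≢ye → Equivalence.from criterion (neither y′≢ye))
        where
        criterion : Adj g h ⇔ (¬ (ωᴾ i ≡ ωᴾ i′ ⊎ ωᴾ i * y ≡ ωᴾ i′ * y′))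
        criterion = adjacent⇔ {i} {i′} {y} {y′} {g} {h} g∈ h∈
        neither : y′ ≢ y * e → ¬ (ωᴾ i ≡ ωᴾ i′ ⊎ ωᴾ i * y ≡ ωᴾ i′ * y′)
        neither _     (inj₁ ωᴾi≡ωᴾi′) = i≢i′ (ωᴾ-injective i<q-1 i′<q-1 ωᴾi≡ωᴾi′)
        neither y′≢ye (inj₂ eq)       = y′≢ye (ωᴾ-condition⇒ eq)

      coclique⇔ : ∀ {y y′} → y ≢ 0# → y′ ≢ 0# → Coclique (InωφE ω i j y ∪ InωφE ω i′ j y′) ⇔ (y′ ≡ y * e)
      coclique⇔ {y} {y′} y≢0 y′≢0 = mk⇔ necessary sufficient
        where
        necessary : Coclique (InωφE ω i j y ∪ InωφE ω i′ j y′) → y′ ≡ y * e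
        necessary coclique = decidable-stable (y′ ≟ y * e) (λ y′≢ye →
          coclique g₀ h₀ (inj₁ g₀∈) (inj₂ h₀∈)
                   (Equivalence.from (cross-adjacent⇔ {y} {y′} {g₀} {h₀} g₀∈ h₀∈) y′≢ye))
          where
          g₀ h₀ : ΓL
          g₀ = coset-element i 0# y y≢0
          h₀ = coset-element i′ 0# y′ y′≢0
          g₀∈ : InωφE ω i j y g₀
          g₀∈ = coset-element-∈ i 0# y y≢0
          h₀∈ : InωφE ω i′ j y′ h₀
          h₀∈ = coset-element-∈ i′ 0# y′ y′≢0
        sufficient : y′ ≡ y * e → Coclique (InωφE ω i j y ∪ InωφE ω i′ j y′)
        sufficient _ g h (inj₁ g∈) (inj₁ h∈) = same-coset-nonadjacent {i} {y} {y} {g} {h} g∈ h∈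
        sufficient _ g h (inj₂ g∈) (inj₂ h∈) = same-coset-nonadjacent {i′} {y′} {y′} {g} {h} g∈ h∈
        sufficient y′≡ye g h (inj₁ g∈) (inj₂ h∈) adj =
          Equivalence.to (cross-adjacent⇔ {y} {y′} {g} {h} g∈ h∈) adj y′≡ye
        sufficient y′≡ye g h (inj₂ g∈) (inj₁ h∈) adj =
          Equivalence.to (cross-adjacent⇔ {y} {y′} {h} {g} h∈ g∈) (Adj-sym {g} {h} adj) y′≡ye

      completeBipartite : ∀ {y y′} → y′ ≢ y * e → CompleteBipartite (InωφE ω i j y) (InωφE ω i′ j y′)
      completeBipartite {y} {y′} y′≢ye =
        (λ g h → same-coset-nonadjacent {i} {y} {y} {g} {h}) ,
        (λ g h → same-coset-nonadjacent {i′} {y′} {y′} {g} {h}) ,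
        (λ g h g∈ h∈ → Equivalence.from (cross-adjacent⇔ {y} {y′} {g} {h} g∈ h∈) y′≢ye)

      Vertex : Set
      Vertex = (Fin 2 × Fin q-1) × Fin (p ^ k)

      exponent : Fin 2 → ℕ
      exponent 0F = i
      exponent 1F = i′

      exponent<q-1 : ∀ a → exponent a < q-1
      exponent<q-1 0F = i<q-1
      exponent<q-1 1F = i′<q-1

      exponent-injective : ∀ {a b} → exponent a ≡ exponent b → a ≡ b
      exponent-injective {0F} {0F} _ = refl
      exponent-injective {1F} {1F} _ = refl
      exponent-injective {0F} {1F} i≡i′ = ⊥-elim (i≢i′ i≡i′)
      exponent-injective {1F} {0F} i′≡i = ⊥-elim (i≢i′ (sym i′≡i))

      -- The second coset is shifted by e so that vertices with the same label x are never adjacent.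
      coordinate : Fin 2 → Fin q-1 → F
      coordinate 0F x = ω ^ᶠ toℕ x
      coordinate 1F x = e * ω ^ᶠ toℕ x

      coordinate≢0 : ∀ a x → coordinate a x ≢ 0#
      coordinate≢0 0F x = x^ᶠn≢0 (toℕ x) ω≢0
      coordinate≢0 1F x = x*y≢0 e≢0 (x^ᶠn≢0 (toℕ x) ω≢0)

      ωᴾ*coordinate : ∀ a x → ωᴾ (exponent a) * coordinate a x ≡ ωᴾ i * ω ^ᶠ toℕ x
      ωᴾ*coordinate 0F x = refl
      ωᴾ*coordinate 1F x = begin
        ωᴾ i′ * (e * ω ^ᶠ toℕ x)   ≡⟨ solve 3 (λ u e w → u :* (e :* w) := (e :* u) :* w) refl (ωᴾ i′) e (ω ^ᶠ toℕ x) ⟩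
        (e * ωᴾ i′) * ω ^ᶠ toℕ x   ≡⟨ cong (_* ω ^ᶠ toℕ x) e*ωᴾi′≡ωᴾi ⟩
        ωᴾ i * ω ^ᶠ toℕ x          ∎
        where open ≡-Reasoning

      label-injective : ∀ {a b x x′} →
                        ωᴾ (exponent a) * coordinate a x ≡ ωᴾ (exponent b) * coordinate b x′ → x ≡ x′
      label-injective {a} {b} {x} {x′} eq = Fin.toℕ-injective (ω^-injective (Fin.toℕ<n x) (Fin.toℕ<n x′)
        (*-cancelˡ-≢0 (x^ᶠn≢0 (i ℕ.* P) ω≢0) (trans (sym (ωᴾ*coordinate a x)) (trans eq (ωᴾ*coordinate b x′)))))

      coordinate-onto : ∀ a y → y ≢ 0# → ∃[ x ] coordinate a x ≡ y
      coordinate-onto 0F y y≢0 = ω^-onto y y≢0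
      coordinate-onto 1F y y≢0 = let x , ωˣ≡e⁻¹y = ω^-onto (e ⁻¹ * y) (x*y≢0 e⁻¹≢0 y≢0) in x , (begin
        e * ω ^ᶠ toℕ x       ≡⟨ cong (e *_) ωˣ≡e⁻¹y ⟩
        e * (e ⁻¹ * y)       ≡⟨ sym (*-assoc e (e ⁻¹) y) ⟩
        (e * e ⁻¹) * y       ≡⟨ cong (_* y) (inverseʳ e e≢0) ⟩
        1# * y               ≡⟨ *-identityˡ y ⟩
        y                    ∎)
        where
        open ≡-Reasoning
        e⁻¹≢0 : e ⁻¹ ≢ 0#
        e⁻¹≢0 e⁻¹≡0 = 1≢0 (trans (sym (inverseʳ e e≢0)) (trans (cong (e *_) e⁻¹≡0) (zeroʳ e)))

      vertex : Vertex → ΓL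
      vertex ((a , x) , t) = coset-element (exponent a) (element t) (coordinate a x) (coordinate≢0 a x)

      vertex-∈ : ∀ a x t → InωφE ω (exponent a) j (coordinate a x) (vertex ((a , x) , t))
      vertex-∈ a x t = coset-element-∈ (exponent a) (element t) (coordinate a x) (coordinate≢0 a x)

      vertex-∈-union : ∀ v → (InV ω i j ∪ InV ω i′ j) (vertex v)
      vertex-∈-union ((0F , x) , t) = inj₁ (coordinate 0F x , coordinate≢0 0F x , vertex-∈ 0F x t)
      vertex-∈-union ((1F , x) , t) = inj₂ (coordinate 1F x , coordinate≢0 1F x , vertex-∈ 1F x t)

      vertex-injective : ∀ v v′ → vertex v ≈Γ vertex v′ → v ≡ v′
      vertex-injective ((a , x) , t) ((b , x′) , t′) v≈v′ =
        cong₂ _,_ (cong₂ _,_ a≡b x≡x′) (element-injective element-t≡t′)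
        where
        parameters : ω ^ᶠ exponent a ≡ ω ^ᶠ exponent b × element t ≡ element t′ × coordinate a x ≡ coordinate b x′
        parameters = coset-element-injective {exponent a} {exponent b} {element t} {element t′}
                                             {coordinate a x} {coordinate b x′}
                                             {coordinate≢0 a x} {coordinate≢0 b x′} v≈v′
        element-t≡t′ : element t ≡ element t′
        element-t≡t′ = proj₁ (proj₂ parameters)
        a≡b : a ≡ b
        a≡b = exponent-injective (ω^-injective (exponent<q-1 a) (exponent<q-1 b) (proj₁ parameters))
        x≡x′ : x ≡ x′
        x≡x′ = label-injective {a} {b} (cong₂ (λ c y → ωᴾ (exponent c) * y) a≡b (proj₂ (proj₂ parameters)))

      vertex-onto-coset : ∀ a {y g} → y ≢ 0# → InωφE ω (exponent a) j y g → ∃[ v ] vertex v ≈Γ g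
      vertex-onto-coset a {y} {g} y≢0 g∈@(z , _) = let x , coordinate≡y = coordinate-onto a y y≢0 in
        ((a , x) , index z) ,
        coset-element-≈ {exponent a} {element (index z)} {coordinate a x} {y} {g}
                        (coordinate≢0 a x) g∈ (element-index z) coordinate≡y

      vertex-onto : ∀ g → (InV ω i j ∪ InV ω i′ j) g → ∃[ v ] vertex v ≈Γ g
      vertex-onto g (inj₁ (y , y≢0 , g∈)) = vertex-onto-coset 0F {y} {g} y≢0 g∈
      vertex-onto g (inj₂ (y , y≢0 , g∈)) = vertex-onto-coset 1F {y} {g} y≢0 g∈

      vertex-adjacent⇔ : ∀ a x t b x′ t′ → Adj (vertex ((a , x) , t)) (vertex ((b , x′) , t′)) ⇔ (a ≢ b × x ≢ x′)
      vertex-adjacent⇔ a x t b x′ t′ = mk⇔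
        (λ adj → (λ a≡b → Equivalence.to criterion adj (inj₁ (cong (ωᴾ ∘ exponent) a≡b)))
               , (λ x≡x′ → Equivalence.to criterion adj (inj₂ (same-label x≡x′))))
        (λ (a≢b , x≢x′) → Equivalence.from criterion (neither a≢b x≢x′))
        where
        criterion : Adj (vertex ((a , x) , t)) (vertex ((b , x′) , t′)) ⇔
                    (¬ (ωᴾ (exponent a) ≡ ωᴾ (exponent b) ⊎
                        ωᴾ (exponent a) * coordinate a x ≡ ωᴾ (exponent b) * coordinate b x′))
        criterion = adjacent⇔ {exponent a} {exponent b} {coordinate a x} {coordinate b x′}
                              {vertex ((a , x) , t)} {vertex ((b , x′) , t′)} (vertex-∈ a x t) (vertex-∈ b x′ t′)
        same-label : x ≡ x′ → ωᴾ (exponent a) * coordinate a x ≡ ωᴾ (exponent b) * coordinate b x′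
        same-label refl = trans (ωᴾ*coordinate a x) (sym (ωᴾ*coordinate b x))
        neither : a ≢ b → x ≢ x′ → ¬ (ωᴾ (exponent a) ≡ ωᴾ (exponent b) ⊎
                                      ωᴾ (exponent a) * coordinate a x ≡ ωᴾ (exponent b) * coordinate b x′)
        neither a≢b _ (inj₁ eq) = a≢b (exponent-injective (ωᴾ-injective (exponent<q-1 a) (exponent<q-1 b) eq))
        neither _ x≢x′ (inj₂ eq) = x≢x′ (label-injective {a} {b} eq)

      inducedIso : InducedIso (InV ω i j ∪ InV ω i′ j) Vertex (Lex (K̃-adj q-1 2) (K̄-adj (p ^ k)))
      inducedIso = vertex , vertex-injective , vertex-∈-union , vertex-onto , adjacency
        where
        adjacency : ∀ v v′ → (Lex (K̃-adj q-1 2) (K̄-adj (p ^ k)) v v′ → Adj (vertex v) (vertex v′)) ×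
                             (Adj (vertex v) (vertex v′) → Lex (K̃-adj q-1 2) (K̄-adj (p ^ k)) v v′)
        adjacency ((a , x) , t) ((b , x′) , t′) =
          (λ { (inj₁ a≢b×x≢x′) → Equivalence.from (vertex-adjacent⇔ a x t b x′ t′) a≢b×x≢x′ ; (inj₂ (_ , ())) }) ,
          (λ adj → inj₁ (Equivalence.to (vertex-adjacent⇔ a x t b x′ t′) adj))

-- Opened only here: in scope above, `+_` would make sections such as (x +_) ambiguous.
open import Data.Integer using (+_)

lemma3p1 : (p k : ℕ) → Prime p → 1 ≤ k → (FF : FiniteField p k) →
    let open FiniteField FF in
    (ω : F) → IsPrimitive ω →
    (i i' j : ℕ) → i < p ^ k ∸ 1 → i' < p ^ k ∸ 1 → i ≢ i' → j < k →
    (y y' : F) → y ≢ 0# → y' ≢ 0# →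
    let e = ω ^ᶻ ((+ i ℤ.- + i') ℤ.* + (p ^ (k ∸ j))) in
    (Coclique (InωφE ω i j y ∪ InωφE ω i' j y') ⇔ (y' ≡ y * e)) ×
    (y' ≢ y * e → CompleteBipartite (InωφE ω i j y) (InωφE ω i' j y')) ×
    InducedIso (InV ω i j ∪ InV ω i' j)
      ((Fin 2 × Fin (p ^ k ∸ 1)) × Fin (p ^ k))
      (Lex (K̃-adj (p ^ k ∸ 1) 2) (K̄-adj (p ^ k)))
lemma3p1 p k p-prime 1≤k FF ω ω-primitive i i' j i<q-1 i'<q-1 i≢i' j<k y y' y≢0 y'≢0 =
  coclique⇔ y≢0 y'≢0 , completeBipartite , inducedIso
  where
  open DerangementGraph p-prime 1≤k FF ω-primitive
  open Cosets j<k
  open CosetPair i<q-1 i'<q-1 i≢i'
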